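{- Let $n\ge1$ and let $\pi$ be a permutation of $[n]=\{1,\dots,n\}$. Then $\mathrm{ov}(\pi)=\mathrm{wt}(\pi)-\mathrm{cross}(\pi)$.
   Context: For a permutation $\pi$ of $[n]$ (equivalently a perfect matching with edges $(i,\overline{\pi(i)})$): $\mathrm{wt}(\pi)=\sum_{i:\,\pi(i)\ge i}(\pi(i)-i)+\sum_{i:\,\pi(i)<i}(i-\pi(i)-1)$; $\mathrm{ov}(\pi)=\left|\{(i,j)\in[n]\times[n]: i<j\le\pi(i)<\pi(j)\ \text{or}\ \pi(j)<\pi(i)<j<i\}\right|$; $\mathrm{cross}(\pi)=\left|\{(i,j)\in[n]\times[n]: i<j,\ \pi(i)>\pi(j)\}\right|$. -}

module Defs where

open import Data.Nat using (ℕ; zero; suc; _+_; _∸_; _≤_; _<_; _≤?_; _<?_)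
open import Data.Fin using (Fin; toℕ)
open import Data.Fin.Permutation using (Permutation′; _⟨$⟩ʳ_)
open import Data.Nat.ListAction using (sum)
open import Data.List using (List; map; length; filter; allFin; cartesianProduct)
open import Data.Product using (_×_; _,_; proj₁; proj₂)
open import Data.Sum using (_⊎_)
open import Relation.Nullary using (Dec; yes; no)
open import Relation.Nullary.Decidable using (_×-dec_; _⊎-dec_)

-- Elements of [n] are represented by Fin n (i ↦ toℕ i + 1); all quantities
-- below only involve differences and comparisons, so the shift by 1 is harmless.

wtTerm : ℕ → ℕ → ℕ
wtTerm i p with i ≤? p
... | yes _ = p ∸ i
... | no  _ = (i ∸ p) ∸ 1

wt : {n : ℕ} → Permutation′ n → ℕ
wt {n} π = sum (map (λ i → wtTerm (toℕ i) (toℕ (π ⟨$⟩ʳ i))) (allFin n))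

pairs : (n : ℕ) → List (Fin n × Fin n)
pairs n = cartesianProduct (allFin n) (allFin n)

ovPair : (i j pi pj : ℕ) → Dec ((i < j × j ≤ pi × pi < pj) ⊎ (pj < pi × pi < j × j < i))
ovPair i j pi pj =
  ((i <? j) ×-dec ((j ≤? pi) ×-dec (pi <? pj)))
  ⊎-dec ((pj <? pi) ×-dec ((pi <? j) ×-dec (j <? i)))

ov : {n : ℕ} → Permutation′ n → ℕ
ov {n} π = length (filter
  (λ p → ovPair (toℕ (proj₁ p)) (toℕ (proj₂ p))
                (toℕ (π ⟨$⟩ʳ proj₁ p)) (toℕ (π ⟨$⟩ʳ proj₂ p)))
  (pairs n))

crossPair : (i j pi pj : ℕ) → Dec (i < j × pj < pi)
crossPair i j pi pj = (i <? j) ×-dec (pj <? pi)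

cross : {n : ℕ} → Permutation′ n → ℕ
cross {n} π = length (filter
  (λ p → crossPair (toℕ (proj₁ p)) (toℕ (proj₂ p))
                   (toℕ (π ⟨$⟩ʳ proj₁ p)) (toℕ (π ⟨$⟩ʳ proj₂ p)))
  (pairs n))

-- Double counting. The term of i in wt π counts the x with i < x ≤ π i or π i < x < i,
-- and equally many x with i ≤ x < π i or π i < x < i. Writing x as j in the first
-- count and as π j in the second (π is a bijection) gives 2 wt π = Σ_{i,j} K(i,j).
-- K(i,j) depends only on the relative order of i, j, π i, π j, and a check of all
-- order types gives K(i,j) + K(j,i) = 2 (Y(i,j) + Y(j,i)), where Y(i,j) is the number
-- of the conditions overlap and crossing that (i,j) satisfies; neither count alone
-- symmetrises like this. Summing over all pairs, 4 wt π = 4 (ov π + cross π).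

module Submission where

open import Data.Bool using (Bool; true; false; _∧_; _∨_; not)
open import Data.Bool.Properties using (∧-zeroʳ)
open import Data.Fin as Fin using (Fin; toℕ)
open import Data.Fin.Permutation using (Permutation′; _⟨$⟩ʳ_)
open import Data.Fin.Properties using (toℕ<n; toℕ-injective)
open import Data.Integer using (+_; _-_; _⊖_)
open import Data.Integer.Properties using (m-n≡m⊖n; ⊖-≥)
open import Data.List using ([]; _∷_; _++_; tabulate; map; length; filter; allFin; cartesianProduct)
open import Data.List.Properties using (map-++; map-∘; map-tabulate)
open import Data.Nat using (ℕ; zero; suc; _+_; _*_; _∸_; _≤_; _<_; _≥_; _<?_; _≤?_; _≟_; s≤s)
open import Data.Nat.ListAction using (sum)
open import Data.Nat.ListAction.Properties using (sum-++)
open import Data.Nat.Properties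
  using ( +-0-commutativeMonoid; +-comm; +-identityʳ; *-cancelˡ-≡; 0∸n≡0; m≤n⇒m∸n≡0; ∸-+-assoc
        ; ≰⇒>; <⇒≤; m≤n⇒m≤1+n; m+n∸n≡m; m≤n+m)
open import Data.Product using (_×_; _,_)
open import Function using (_∘_; id)
open import Relation.Nullary using (Dec; does; yes; no)
open import Relation.Nullary.Decidable using (does-⇔)
open import Function.Bundles using (_⇔_; mk⇔; Injection)
open import Function.Properties.Inverse using (↔⇒↣)
open import Relation.Binary.PropositionalEquality
open ≡-Reasoning

open import Algebra.Properties.CommutativeMonoid.Sum +-0-commutativeMonoid
  using (sum-syntax; sum-cong-≗; sum-replicate-zero; ∑-distrib-+; ∑-comm; ∑-permute)
  renaming (sum to ∑)

open import Defs

⟦_⟧ : Bool → ℕ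
⟦ true ⟧ = 1
⟦ false ⟧ = 0

sum-tabulate : ∀ n (f : Fin n → ℕ) → sum (tabulate f) ≡ ∑[ i < n ] f i
sum-tabulate zero f = refl
sum-tabulate (suc n) f = cong (_+_ (f Fin.zero)) (sum-tabulate n (f ∘ Fin.suc))

sum-map-allFin : ∀ n (f : Fin n → ℕ) → sum (map f (allFin n)) ≡ ∑[ i < n ] f i
sum-map-allFin n f = trans (cong sum (map-tabulate id f)) (sum-tabulate n f)

length-filter : ∀ {A : Set} {P : A → Set} (P? : ∀ x → Dec (P x)) xs →
  length (filter P? xs) ≡ sum (map (λ x → ⟦ does (P? x) ⟧) xs)
length-filter P? [] = refl
length-filter P? (x ∷ xs) with does (P? x)
... | true  = cong suc (length-filter P? xs)
... | false = length-filter P? xs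

sum-map-cartesianProduct : ∀ {A B : Set} (f : A × B → ℕ) xs ys →
  sum (map f (cartesianProduct xs ys)) ≡ sum (map (λ x → sum (map (λ y → f (x , y)) ys)) xs)
sum-map-cartesianProduct f [] ys = refl
sum-map-cartesianProduct f (x ∷ xs) ys = begin
  sum (map f (map (x ,_) ys ++ cartesianProduct xs ys))
    ≡⟨ cong sum (map-++ f (map (x ,_) ys) _) ⟩
  sum (map f (map (x ,_) ys) ++ map f (cartesianProduct xs ys))
    ≡⟨ sum-++ (map f (map (x ,_) ys)) _ ⟩
  sum (map f (map (x ,_) ys)) + sum (map f (cartesianProduct xs ys))
    ≡⟨ cong₂ _+_ (cong sum (sym (map-∘ ys))) (sum-map-cartesianProduct f xs ys) ⟩
  sum (map (λ y → f (x , y)) ys) + sum (map (λ x → sum (map (λ y → f (x , y)) ys)) xs)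
    ∎

sum-map-pairs : ∀ n (f : Fin n × Fin n → ℕ) → sum (map f (pairs n)) ≡ ∑[ i < n ] ∑[ j < n ] f (i , j)
sum-map-pairs n f = begin
  sum (map f (pairs n))
    ≡⟨ sum-map-cartesianProduct f (allFin n) (allFin n) ⟩
  sum (map (λ i → sum (map (λ j → f (i , j)) (allFin n))) (allFin n))
    ≡⟨ sum-map-allFin n _ ⟩
  ∑[ i < n ] sum (map (λ j → f (i , j)) (allFin n))
    ≡⟨ sum-cong-≗ (λ i → sum-map-allFin n (λ j → f (i , j))) ⟩
  ∑[ i < n ] ∑[ j < n ] f (i , j)
    ∎

length-filter-pairs : ∀ n {P : Fin n × Fin n → Set} (P? : ∀ x → Dec (P x)) →
  length (filter P? (pairs n)) ≡ ∑[ i < n ] ∑[ j < n ] ⟦ does (P? (i , j)) ⟧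
length-filter-pairs n P? = trans (length-filter P? (pairs n)) (sum-map-pairs n _)

+-double-injective : ∀ m n → m + m ≡ n + n → m ≡ n
+-double-injective m n m+m≡n+n = *-cancelˡ-≡ m n 2 (begin
  2 * m      ≡⟨ cong (_+_ m) (+-identityʳ m) ⟩
  m + m      ≡⟨ m+m≡n+n ⟩
  n + n      ≡⟨ cong (_+_ n) (+-identityʳ n) ⟨
  2 * n      ∎)

∑∑-distrib-+ : ∀ n (f g : Fin n → Fin n → ℕ) →
  ∑[ i < n ] ∑[ j < n ] (f i j + g i j) ≡ ∑[ i < n ] ∑[ j < n ] f i j + ∑[ i < n ] ∑[ j < n ] g i j
∑∑-distrib-+ n f g = trans (sum-cong-≗ {n} (λ i → ∑-distrib-+ {n} (f i) (g i))) (∑-distrib-+ {n} _ _)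

∑∑-symmetrize : ∀ n (f : Fin n → Fin n → ℕ) →
  ∑[ i < n ] ∑[ j < n ] (f i j + f j i) ≡ ∑[ i < n ] ∑[ j < n ] f i j + ∑[ i < n ] ∑[ j < n ] f i j
∑∑-symmetrize n f = begin
  ∑[ i < n ] ∑[ j < n ] (f i j + f j i)
    ≡⟨ ∑∑-distrib-+ n f (λ i j → f j i) ⟩
  ∑[ i < n ] ∑[ j < n ] f i j + ∑[ i < n ] ∑[ j < n ] f j i
    ≡⟨ cong (_+_ (∑[ i < n ] ∑[ j < n ] f i j)) (∑-comm f) ⟨
  ∑[ i < n ] ∑[ j < n ] f i j + ∑[ i < n ] ∑[ j < n ] f i j
    ∎

does-≤?-suc : ∀ m n → does (suc m ≤? suc n) ≡ does (m ≤? n)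
does-≤?-suc zero    n = refl
does-≤?-suc (suc m) n = refl

inRange : ℕ → ℕ → ℕ → Bool
inRange a b x = does (a ≤? x) ∧ does (x <? b)

∑-inRange : ∀ n a b → b ≤ n → ∑[ x < n ] ⟦ inRange a b (toℕ x) ⟧ ≡ b ∸ a
∑-inRange n a zero _ = begin
  ∑[ x < n ] ⟦ does (a ≤? toℕ x) ∧ false ⟧
    ≡⟨ sum-cong-≗ {n} (λ x → cong ⟦_⟧ (∧-zeroʳ (does (a ≤? toℕ x)))) ⟩
  ∑[ x < n ] 0
    ≡⟨ sum-replicate-zero n ⟩
  0
    ≡⟨ sym (0∸n≡0 a) ⟩
  0 ∸ a
    ∎
∑-inRange (suc n) zero (suc b) (s≤s b≤n) = cong suc (begin
  ∑[ x < n ] ⟦ does (suc (toℕ x) <? suc b) ⟧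
    ≡⟨ sum-cong-≗ {n} (λ x → cong ⟦_⟧ (does-≤?-suc (suc (toℕ x)) b)) ⟩
  ∑[ x < n ] ⟦ inRange zero b (toℕ x) ⟧
    ≡⟨ ∑-inRange n zero b b≤n ⟩
  b ∸ zero
    ∎)
∑-inRange (suc n) (suc a) (suc b) (s≤s b≤n) = begin
  ∑[ x < n ] ⟦ inRange (suc a) (suc b) (suc (toℕ x)) ⟧
    ≡⟨ sum-cong-≗ {n} (λ x → cong₂ (λ s t → ⟦ s ∧ t ⟧) (does-≤?-suc a (toℕ x))
                                                     (does-≤?-suc (suc (toℕ x)) b)) ⟩
  ∑[ x < n ] ⟦ inRange a b (toℕ x) ⟧
    ≡⟨ ∑-inRange n a b b≤n ⟩
  b ∸ a
    ∎

wtTerm-split : ∀ i p → wtTerm i p ≡ (p ∸ i) + (i ∸ suc p)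
wtTerm-split i p with i ≤? p
... | yes i≤p = begin
  p ∸ i                   ≡⟨ +-identityʳ (p ∸ i) ⟨
  (p ∸ i) + 0             ≡⟨ cong (_+_ (p ∸ i)) (sym (m≤n⇒m∸n≡0 (m≤n⇒m≤1+n i≤p))) ⟩
  (p ∸ i) + (i ∸ suc p)   ∎
... | no i≰p = begin
  (i ∸ p) ∸ 1             ≡⟨ ∸-+-assoc i p 1 ⟩
  i ∸ (p + 1)             ≡⟨ cong (i ∸_) (+-comm p 1) ⟩
  i ∸ suc p               ≡⟨ cong (_+ (i ∸ suc p)) (sym (m≤n⇒m∸n≡0 (<⇒≤ (≰⇒> i≰p)))) ⟩
  (p ∸ i) + (i ∸ suc p)   ∎

arcᴿ arcᴸ : ℕ → ℕ → ℕ → ℕ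
arcᴿ i p x = ⟦ does (i <? x) ∧ does (x ≤? p) ⟧ + ⟦ does (p <? x) ∧ does (x <? i) ⟧
arcᴸ i p x = ⟦ does (i ≤? x) ∧ does (x <? p) ⟧ + ⟦ does (p <? x) ∧ does (x <? i) ⟧

∑-arcᴿ : ∀ n i p → i < n → p < n → ∑[ x < n ] arcᴿ i p (toℕ x) ≡ wtTerm i p
∑-arcᴿ n i p i<n p<n = begin
  ∑[ x < n ] arcᴿ i p (toℕ x)
    ≡⟨ sum-cong-≗ {n} (λ x → cong (λ t → ⟦ does (i <? toℕ x) ∧ t ⟧ + ⟦ inRange (suc p) i (toℕ x) ⟧)
                                  (sym (does-≤?-suc (toℕ x) p))) ⟩
  ∑[ x < n ] (⟦ inRange (suc i) (suc p) (toℕ x) ⟧ + ⟦ inRange (suc p) i (toℕ x) ⟧)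
    ≡⟨ ∑-distrib-+ {n} _ _ ⟩
  ∑[ x < n ] ⟦ inRange (suc i) (suc p) (toℕ x) ⟧ + ∑[ x < n ] ⟦ inRange (suc p) i (toℕ x) ⟧
    ≡⟨ cong₂ _+_ (∑-inRange n (suc i) (suc p) p<n) (∑-inRange n (suc p) i (<⇒≤ i<n)) ⟩
  (p ∸ i) + (i ∸ suc p)
    ≡⟨ sym (wtTerm-split i p) ⟩
  wtTerm i p
    ∎

∑-arcᴸ : ∀ n i p → i < n → p < n → ∑[ x < n ] arcᴸ i p (toℕ x) ≡ wtTerm i p
∑-arcᴸ n i p i<n p<n = begin
  ∑[ x < n ] arcᴸ i p (toℕ x)
    ≡⟨ ∑-distrib-+ {n} _ _ ⟩
  ∑[ x < n ] ⟦ inRange i p (toℕ x) ⟧ + ∑[ x < n ] ⟦ inRange (suc p) i (toℕ x) ⟧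
    ≡⟨ cong₂ _+_ (∑-inRange n i p (<⇒≤ p<n)) (∑-inRange n (suc p) i (<⇒≤ i<n)) ⟩
  (p ∸ i) + (i ∸ suc p)
    ≡⟨ sym (wtTerm-split i p) ⟩
  wtTerm i p
    ∎

data Comparison : Set where
  lt eq gt : Comparison

cmp : ℕ → ℕ → Comparison
cmp zero    zero    = eq
cmp zero    (suc n) = lt
cmp (suc m) zero    = gt
cmp (suc m) (suc n) = cmp m n

isLt isEq isGt : Comparison → Bool
isLt lt = true
isLt _  = false
isEq eq = true
isEq _  = false
isGt gt = true
isGt _  = false

does-<? : ∀ m n → does (m <? n) ≡ isLt (cmp m n)
does-<? zero    zero    = refl
does-<? zero    (suc n) = refl
does-<? (suc m) zero    = refl
does-<? (suc m) (suc n) = does-<? m n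

does-<?-swap : ∀ m n → does (n <? m) ≡ isGt (cmp m n)
does-<?-swap zero    zero    = refl
does-<?-swap zero    (suc n) = refl
does-<?-swap (suc m) zero    = refl
does-<?-swap (suc m) (suc n) = does-<?-swap m n

does-≤? : ∀ m n → does (m ≤? n) ≡ not (isGt (cmp m n))
does-≤? zero    zero    = refl
does-≤? zero    (suc n) = refl
does-≤? (suc m) zero    = refl
does-≤? (suc m) (suc n) = trans (does-≤?-suc m n) (does-≤? m n)

does-≟ : ∀ m n → does (m ≟ n) ≡ isEq (cmp m n)
does-≟ zero    zero    = refl
does-≟ zero    (suc n) = refl
does-≟ (suc m) zero    = refl
does-≟ (suc m) (suc n) = does-≟ m n

arcCount ovCross : (i j pi pj : ℕ) → ℕ
arcCount i j pi pj = arcᴿ i pi j + arcᴸ i pi pj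
ovCross  i j pi pj = ⟦ does (ovPair i j pi pj) ⟧ + ⟦ does (crossPair i j pi pj) ⟧

-- arcCount i j pi pj + arcCount j i pj pi and ovCross i j pi pj + ovCross j i pj pi,
-- with every comparison expressed through ij = cmp i j, ππ = cmp pi pj,
-- jπ = cmp j pi and iπ = cmp i pj.
arcCountᶜ ovCrossᶜ : (ij ππ jπ iπ : Comparison) → ℕ
arcCountᶜ ij ππ jπ iπ =
    (⟦ isLt ij ∧ not (isGt jπ) ⟧ + ⟦ isGt jπ ∧ isGt ij ⟧)
  + (⟦ not (isGt iπ) ∧ isGt ππ ⟧ + ⟦ isLt ππ ∧ isGt iπ ⟧)
  + ((⟦ isGt ij ∧ not (isGt iπ) ⟧ + ⟦ isGt iπ ∧ isLt ij ⟧)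
  + (⟦ not (isGt jπ) ∧ isLt ππ ⟧ + ⟦ isGt ππ ∧ isGt jπ ⟧))
ovCrossᶜ ij ππ jπ iπ =
    (⟦ (isLt ij ∧ (not (isGt jπ) ∧ isLt ππ)) ∨ (isGt ππ ∧ (isGt jπ ∧ isGt ij)) ⟧ + ⟦ isLt ij ∧ isGt ππ ⟧)
  + (⟦ (isGt ij ∧ (not (isGt iπ) ∧ isGt ππ)) ∨ (isLt ππ ∧ (isGt iπ ∧ isLt ij)) ⟧ + ⟦ isGt ij ∧ isLt ππ ⟧)

arcCountᶜ≡ovCrossᶜ : ∀ ij ππ jπ iπ → isEq ij ≡ isEq ππ →
  arcCountᶜ ij ππ jπ iπ ≡ ovCrossᶜ ij ππ jπ iπ + ovCrossᶜ ij ππ jπ iπ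
arcCountᶜ≡ovCrossᶜ lt lt lt lt _  = refl
arcCountᶜ≡ovCrossᶜ lt lt lt eq _  = refl
arcCountᶜ≡ovCrossᶜ lt lt lt gt _  = refl
arcCountᶜ≡ovCrossᶜ lt lt eq lt _  = refl
arcCountᶜ≡ovCrossᶜ lt lt eq eq _  = refl
arcCountᶜ≡ovCrossᶜ lt lt eq gt _  = refl
arcCountᶜ≡ovCrossᶜ lt lt gt lt _  = refl
arcCountᶜ≡ovCrossᶜ lt lt gt eq _  = refl
arcCountᶜ≡ovCrossᶜ lt lt gt gt _  = refl
arcCountᶜ≡ovCrossᶜ lt eq _  _  ()
arcCountᶜ≡ovCrossᶜ lt gt lt lt _  = refl
arcCountᶜ≡ovCrossᶜ lt gt lt eq _  = refl
arcCountᶜ≡ovCrossᶜ lt gt lt gt _  = refl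
arcCountᶜ≡ovCrossᶜ lt gt eq lt _  = refl
arcCountᶜ≡ovCrossᶜ lt gt eq eq _  = refl
arcCountᶜ≡ovCrossᶜ lt gt eq gt _  = refl
arcCountᶜ≡ovCrossᶜ lt gt gt lt _  = refl
arcCountᶜ≡ovCrossᶜ lt gt gt eq _  = refl
arcCountᶜ≡ovCrossᶜ lt gt gt gt _  = refl
arcCountᶜ≡ovCrossᶜ eq lt _  _  ()
arcCountᶜ≡ovCrossᶜ eq eq lt lt _  = refl
arcCountᶜ≡ovCrossᶜ eq eq lt eq _  = refl
arcCountᶜ≡ovCrossᶜ eq eq lt gt _  = refl
arcCountᶜ≡ovCrossᶜ eq eq eq lt _  = refl
arcCountᶜ≡ovCrossᶜ eq eq eq eq _  = refl
arcCountᶜ≡ovCrossᶜ eq eq eq gt _  = refl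
arcCountᶜ≡ovCrossᶜ eq eq gt lt _  = refl
arcCountᶜ≡ovCrossᶜ eq eq gt eq _  = refl
arcCountᶜ≡ovCrossᶜ eq eq gt gt _  = refl
arcCountᶜ≡ovCrossᶜ eq gt _  _  ()
arcCountᶜ≡ovCrossᶜ gt lt lt lt _  = refl
arcCountᶜ≡ovCrossᶜ gt lt lt eq _  = refl
arcCountᶜ≡ovCrossᶜ gt lt lt gt _  = refl
arcCountᶜ≡ovCrossᶜ gt lt eq lt _  = refl
arcCountᶜ≡ovCrossᶜ gt lt eq eq _  = refl
arcCountᶜ≡ovCrossᶜ gt lt eq gt _  = refl
arcCountᶜ≡ovCrossᶜ gt lt gt lt _  = refl
arcCountᶜ≡ovCrossᶜ gt lt gt eq _  = refl
arcCountᶜ≡ovCrossᶜ gt lt gt gt _  = refl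
arcCountᶜ≡ovCrossᶜ gt eq _  _  ()
arcCountᶜ≡ovCrossᶜ gt gt lt lt _  = refl
arcCountᶜ≡ovCrossᶜ gt gt lt eq _  = refl
arcCountᶜ≡ovCrossᶜ gt gt lt gt _  = refl
arcCountᶜ≡ovCrossᶜ gt gt eq lt _  = refl
arcCountᶜ≡ovCrossᶜ gt gt eq eq _  = refl
arcCountᶜ≡ovCrossᶜ gt gt eq gt _  = refl
arcCountᶜ≡ovCrossᶜ gt gt gt lt _  = refl
arcCountᶜ≡ovCrossᶜ gt gt gt eq _  = refl
arcCountᶜ≡ovCrossᶜ gt gt gt gt _  = refl

arcCount≡ovCross : ∀ i j pi pj → (i ≡ j ⇔ pi ≡ pj) →
  arcCount i j pi pj + arcCount j i pj pi
    ≡ (ovCross i j pi pj + ovCross j i pj pi) + (ovCross i j pi pj + ovCross j i pj pi)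
arcCount≡ovCross i j pi pj i≡j⇔pi≡pj
  rewrite does-<? i j | does-<?-swap i j | does-<? pi pj | does-<?-swap pi pj
        | does-≤? j pi | does-<?-swap j pi | does-≤? i pj | does-<?-swap i pj
  = arcCountᶜ≡ovCrossᶜ (cmp i j) (cmp pi pj) (cmp j pi) (cmp i pj) (begin
      isEq (cmp i j)       ≡⟨ does-≟ i j ⟨
      does (i ≟ j)         ≡⟨ does-⇔ i≡j⇔pi≡pj (i ≟ j) (pi ≟ pj) ⟩
      does (pi ≟ pj)       ≡⟨ does-≟ pi pj ⟩
      isEq (cmp pi pj)     ∎)

module _ {n : ℕ} (π : Permutation′ n) where

  private
    q p : Fin n → ℕ
    q i = toℕ i
    p i = toℕ (π ⟨$⟩ʳ i)

    ∑∑ : (Fin n → Fin n → ℕ) → ℕ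
    ∑∑ f = ∑[ i < n ] ∑[ j < n ] f i j

    q≡q⇔p≡p : ∀ i j → q i ≡ q j ⇔ p i ≡ p j
    q≡q⇔p≡p i j = mk⇔ (cong p ∘ toℕ-injective)
                       (cong toℕ ∘ Injection.injective (↔⇒↣ π) ∘ toℕ-injective)

  ∑∑-arcCount : ∑∑ (λ i j → arcCount (q i) (q j) (p i) (p j)) ≡ wt π + wt π
  ∑∑-arcCount = begin
    ∑[ i < n ] ∑[ j < n ] (arcᴿ (q i) (p i) (q j) + arcᴸ (q i) (p i) (p j))
      ≡⟨ ∑∑-distrib-+ n _ _ ⟩
    ∑[ i < n ] ∑[ j < n ] arcᴿ (q i) (p i) (q j) + ∑[ i < n ] ∑[ j < n ] arcᴸ (q i) (p i) (p j)
      ≡⟨ cong₂ _+_ (sum-cong-≗ {n} ∑-arcᴿ-j) (sum-cong-≗ {n} ∑-arcᴸ-πj) ⟩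
    ∑[ i < n ] wtTerm (q i) (p i) + ∑[ i < n ] wtTerm (q i) (p i)
      ≡⟨ cong₂ _+_ (sum-map-allFin n _) (sum-map-allFin n _) ⟨
    wt π + wt π
      ∎
    where
    ∑-arcᴿ-j : ∀ i → ∑[ j < n ] arcᴿ (q i) (p i) (q j) ≡ wtTerm (q i) (p i)
    ∑-arcᴿ-j i = ∑-arcᴿ n (q i) (p i) (toℕ<n i) (toℕ<n (π ⟨$⟩ʳ i))
    ∑-arcᴸ-πj : ∀ i → ∑[ j < n ] arcᴸ (q i) (p i) (p j) ≡ wtTerm (q i) (p i)
    ∑-arcᴸ-πj i = trans (sym (∑-permute (λ x → arcᴸ (q i) (p i) (toℕ x)) π))
                        (∑-arcᴸ n (q i) (p i) (toℕ<n i) (toℕ<n (π ⟨$⟩ʳ i)))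

  ∑∑-ovCross : ∑∑ (λ i j → ovCross (q i) (q j) (p i) (p j)) ≡ ov π + cross π
  ∑∑-ovCross = begin
    ∑[ i < n ] ∑[ j < n ] (O i j + C i j)   ≡⟨ ∑∑-distrib-+ n O C ⟩
    ∑∑ O + ∑∑ C                             ≡⟨ cong₂ _+_ (length-filter-pairs n _) (length-filter-pairs n _) ⟨
    ov π + cross π                          ∎
    where
    O C : Fin n → Fin n → ℕ
    O i j = ⟦ does (ovPair (q i) (q j) (p i) (p j)) ⟧
    C i j = ⟦ does (crossPair (q i) (q j) (p i) (p j)) ⟧

  wt≡ov+cross : wt π ≡ ov π + cross π
  wt≡ov+cross = +-double-injective _ _ (+-double-injective _ _ (begin
    (wt π + wt π) + (wt π + wt π)
      ≡⟨ cong₂ _+_ ∑∑-arcCount ∑∑-arcCount ⟨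
    ∑∑ K + ∑∑ K
      ≡⟨ ∑∑-symmetrize n K ⟨
    ∑[ i < n ] ∑[ j < n ] (K i j + K j i)
      ≡⟨ sum-cong-≗ {n} (λ i → sum-cong-≗ {n} (λ j →
           arcCount≡ovCross (q i) (q j) (p i) (p j) (q≡q⇔p≡p i j))) ⟩
    ∑[ i < n ] ∑[ j < n ] (Z i j + Z i j)
      ≡⟨ ∑∑-distrib-+ n Z Z ⟩
    ∑∑ Z + ∑∑ Z
      ≡⟨ cong₂ _+_ (∑∑-symmetrize n Y) (∑∑-symmetrize n Y) ⟩
    (∑∑ Y + ∑∑ Y) + (∑∑ Y + ∑∑ Y)
      ≡⟨ cong₂ _+_ (cong₂ _+_ ∑∑-ovCross ∑∑-ovCross) (cong₂ _+_ ∑∑-ovCross ∑∑-ovCross) ⟩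
    ((ov π + cross π) + (ov π + cross π)) + ((ov π + cross π) + (ov π + cross π))
      ∎))
    where
    K Y Z : Fin n → Fin n → ℕ
    K i j = arcCount (q i) (q j) (p i) (p j)
    Y i j = ovCross (q i) (q j) (p i) (p j)
    Z i j = Y i j + Y j i

-- The identity holds for n = 0 as well.
lemma2p6 : (n : ℕ) → n ≥ 1 → (π : Permutation′ n) →
    + ov π ≡ + wt π - + cross π
lemma2p6 n _ π = begin
  + ov π                               ≡⟨ cong +_ (m+n∸n≡m (ov π) (cross π)) ⟨
  + ((ov π + cross π) ∸ cross π)       ≡⟨ ⊖-≥ (m≤n+m (cross π) (ov π)) ⟨
  (ov π + cross π) ⊖ cross π           ≡⟨ m-n≡m⊖n (ov π + cross π) (cross π) ⟨
  + (ov π + cross π) - + cross π       ≡⟨ cong (λ w → + w - + cross π) (wt≡ov+cross π) ⟨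
  + wt π - + cross π                   ∎
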